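{- Let $n\ge1$, $w\in\mathfrak{S}_{n+1}$, and let $Y$ be a set of values of $w$ containing no left-to-right minimum of $w$ and containing every right-to-left minimum of $w$ other than $1$. For every cover relation $a\prec b$ in the poset $P_{w,Y}$ with vertex-labeling $\Lambda$, we have $a<b$ if and only if $\Lambda(a)>\Lambda(b)$ (comparisons as integers).
   Context: Write $w$ in one-line notation $w_1\cdots w_{n+1}$; bar $j$ ($1\le j\le n$) is the gap between $w_j$ and $w_{j+1}$. For a position $i$ put $\ell=\max\{j<i:w_j<w_i\}$ and $r=\min\{j>i:w_j<w_i\}$ (when they exist; $\ell$ fails to exist iff $w_i$ is a left-to-right minimum, $r$ fails to exist iff $w_i$ is a right-to-left minimum). The poset $P=P_{w,Y}$ on $\{1,\dots,n\}$ (transitive closure of the cover relations added below, starting with no relations) and the injective labeling $\Lambda:\{1,\dots,n\}\to\mathbb{Z}$ are built by processing the values $v=n+1,n,\dots,2$ in this order; let $i$ be the position with $w_i=v$. If $w_i$ is not a left-to-right minimum, let $a$ be the unique maximal element, in the poset built so far, of the set $\{\ell,\dots,i-1\}$ (which is connected with a unique maximum); if $w_i$ is not a right-to-left minimum, let $b$ be the unique maximal element of $\{i,\dots,r-1\}$. If $w_i$ is a left-to-right minimum (hence not a right-to-left minimum), set $\Lambda(b)=-w_i$. If $w_i$ is a right-to-left minimum (hence not a left-to-right minimum), set $\Lambda(a)=w_i$. If $w_i$ is neither, then: if $w_i\in Y$, add the cover relation $a\prec b$ and set $\Lambda(a)=w_i$; if $w_i\notin Y$, add $b\prec a$ and set $\Lambda(b)=-w_i$.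 -}

module Defs where

open import Data.Nat using (ℕ; zero; suc; _<_; _≤_)
open import Data.Integer as ℤ using (ℤ; +_; -_)
open import Data.Fin using (Fin; toℕ)
open import Data.Fin.Permutation using (Permutation′; _⟨$⟩ʳ_)
open import Data.Product using (_×_; _,_; ∃; ∃-syntax)
open import Data.List using (List; []; _∷_)
open import Data.List.Membership.Propositional using (_∈_)
open import Relation.Binary.PropositionalEquality using (_≡_)
open import Relation.Binary.Construct.Closure.Transitive using (TransClosure)
open import Data.Sum using (_⊎_)
open import Relation.Nullary using (¬_)

-- Conventions: w ∈ 𝔖_{n+1} is a permutation π of Fin (suc n).
-- Positions are elements p : Fin (suc n) (position p stands for the
-- 1-based position toℕ p + 1).
-- Bars are elements k : Fin n (bar k stands for the 1-based bar toℕ k + 1,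
-- i.e. the gap between (0-based) positions k and k+1).  With this
-- convention the 1-based bar set {ℓ,…,i-1} between 1-based positions
-- ℓ and i is the set of bars k with toℕ l ≤ toℕ k < toℕ i, where l, i
-- are the corresponding 0-based positions.

module _ {n : ℕ} (π : Permutation′ (suc n)) where

  val : Fin (suc n) → ℕ
  val p = suc (toℕ (π ⟨$⟩ʳ p))

  LTRMin : Fin (suc n) → Set
  LTRMin i = ∀ (j : Fin (suc n)) → toℕ j < toℕ i → val i < val j

  RTLMin : Fin (suc n) → Set
  RTLMin i = ∀ (j : Fin (suc n)) → toℕ i < toℕ j → val i < val j

  IsLeft : Fin (suc n) → Fin (suc n) → Set
  IsLeft i l = toℕ l < toℕ i × val l < val i ×
               (∀ (j : Fin (suc n)) → toℕ l < toℕ j → toℕ j < toℕ i → val i < val j)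

  IsRight : Fin (suc n) → Fin (suc n) → Set
  IsRight i r = toℕ i < toℕ r × val r < val i ×
                (∀ (j : Fin (suc n)) → toℕ i < toℕ j → toℕ j < toℕ r → val i < val j)

-- Posets built so far: the transitive closure of a list of added cover
-- relations; (x , y) ∈ E means that x ≺ y was added.
Edges : ℕ → Set
Edges n = List (Fin n × Fin n)

Labels : ℕ → Set
Labels n = List (Fin n × ℤ)

module _ {n : ℕ} (E : Edges n) where

  Added : Fin n → Fin n → Set
  Added x y = (x , y) ∈ E

  _<P_ : Fin n → Fin n → Set
  _<P_ = TransClosure Added

  Cover : Fin n → Fin n → Set
  Cover a b = a <P b × ¬ (∃[ c ] (a <P c × c <P b))

  InRange : ℕ → ℕ → Fin n → Set
  InRange lo hi k = lo ≤ toℕ k × toℕ k < hi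

  Maximal : (Fin n → Set) → Fin n → Set
  Maximal S a = S a × (∀ s → S s → ¬ (a <P s))

  UniqueMax : (Fin n → Set) → Fin n → Set
  UniqueMax S a = Maximal S a × (∀ s → Maximal S s → s ≡ a)

-- Built π Y m E L : after processing the (1-based) values n+1, n, …, m+1
-- (in this order) the cover relations added are E and the label
-- assignments made are L (most recent first).  Start: m = n+1.
-- The step processes the value v = suc (toℕ x) (with toℕ x ≥ 1, i.e. v ≥ 2)
-- at position i = w⁻¹(v).
data Built {n : ℕ} (π : Permutation′ (suc n)) (Y : ℕ → Set)
     : ℕ → Edges n → Labels n → Set where
  start : Built π Y (suc n) [] []
  stepLTR : ∀ {E L} (x : Fin (suc n)) → 1 ≤ toℕ x →
    Built π Y (suc (toℕ x)) E L →
    ∀ (i : Fin (suc n)) → π ⟨$⟩ʳ i ≡ x →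
    LTRMin π i →
    ∀ (r : Fin (suc n)) (b : Fin n) → IsRight π i r →
    UniqueMax E (InRange E (toℕ i) (toℕ r)) b →
    Built π Y (toℕ x) E ((b , - (+ val π i)) ∷ L)
  stepRTL : ∀ {E L} (x : Fin (suc n)) → 1 ≤ toℕ x →
    Built π Y (suc (toℕ x)) E L →
    ∀ (i : Fin (suc n)) → π ⟨$⟩ʳ i ≡ x →
    RTLMin π i →
    ∀ (l : Fin (suc n)) (a : Fin n) → IsLeft π i l →
    UniqueMax E (InRange E (toℕ l) (toℕ i)) a →
    Built π Y (toℕ x) E ((a , + val π i) ∷ L)
  stepInY : ∀ {E L} (x : Fin (suc n)) → 1 ≤ toℕ x →
    Built π Y (suc (toℕ x)) E L →
    ∀ (i : Fin (suc n)) → π ⟨$⟩ʳ i ≡ x →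
    ∀ (l r : Fin (suc n)) (a b : Fin n) → IsLeft π i l → IsRight π i r →
    UniqueMax E (InRange E (toℕ l) (toℕ i)) a →
    UniqueMax E (InRange E (toℕ i) (toℕ r)) b →
    Y (val π i) →
    Built π Y (toℕ x) ((a , b) ∷ E) ((a , + val π i) ∷ L)
  stepNotInY : ∀ {E L} (x : Fin (suc n)) → 1 ≤ toℕ x →
    Built π Y (suc (toℕ x)) E L →
    ∀ (i : Fin (suc n)) → π ⟨$⟩ʳ i ≡ x →
    ∀ (l r : Fin (suc n)) (a b : Fin n) → IsLeft π i l → IsRight π i r →
    UniqueMax E (InRange E (toℕ l) (toℕ i)) a →
    UniqueMax E (InRange E (toℕ i) (toℕ r)) b →
    ¬ Y (val π i) →
    Built π Y (toℕ x) ((b , a) ∷ E) ((b , - (+ val π i)) ∷ L)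

{-# OPTIONS --safe #-}
-- Values are processed in decreasing order. Once all values above k are processed, the
-- positions of value ≤ k cut the bars into blocks, and processing the position of k + 1
-- merges the two blocks around it. Every labelled bar lies below another bar of its block,
-- so the maximum picked in a block is still unlabelled and each bar is labelled at most once.
-- Adding an edge x ≺ y at value v labels x by ±v (+ iff x is left of y) while y is still
-- unlabelled, so y is labelled later, with a label of absolute value < v. A cover of the
-- transitive closure is an added edge.
module Submission where

open import Defs
open import Data.Nat using (ℕ; suc; _≤_; _<_)
open import Data.Integer using (ℤ)
open import Data.Fin using (Fin; toℕ)
open import Data.Fin.Permutation using (Permutation′)
open import Data.Product using (_×_; _,_)
open import Data.List.Membership.Propositional using (_∈_)
open import Relation.Nullary using (¬_)
open import Function.Bundles using (_⇔_)
open import Relation.Binary.PropositionalEquality using (_≡_)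
import Data.Integer as ℤ

open import Data.Nat using (s≤s)
open import Data.Nat.Properties
  using (<-irrefl; <-asym; <-trans; ≤-trans; <-≤-trans; ≤-<-trans; <⇒≤; ≤-reflexive; <⇒≢;
         n<1+n; n≤1+n; ≤⇒≯; ≤∧≢⇒<; m≤n⇒m≤1+n; m≤n⇒m<n∨m≡n; suc-injective; _<?_; ≮⇒≥)
open import Data.Integer using (+_; -_; -<-; -<+; +<+)
import Data.Integer.Properties as ℤ
open import Data.Fin.Properties using (toℕ-injective)
open import Data.Product using (proj₁; proj₂; ∃; ∃₂)
open import Data.Sum using (_⊎_; inj₁; inj₂)
open import Data.Empty using (⊥-elim)
open import Data.List using (_∷_)
open import Data.List.Relation.Unary.Any using (here; there)
open import Relation.Nullary using (yes; no)
open import Relation.Binary.PropositionalEquality using (refl; sym; trans; cong; subst; _≢_)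
open import Relation.Binary.Construct.Closure.Transitive using ([_]; _∷_)
open import Function using (id)
open import Function.Bundles using (Injection; mk⇔)
open import Function.Properties.Inverse using (↔⇒↣)

private
  variable
    n k v : ℕ
    E : Edges n
    L : Labels n
    x y z : Fin n
    l lx ly : ℤ

Labelled : Labels n → Fin n → Set
Labelled L z = ∃ λ l → (z , l) ∈ L

UniqueLabels : Labels n → Set
UniqueLabels L = ∀ {z l l′} → (z , l) ∈ L → (z , l′) ∈ L → l ≡ l′

uniqueLabels-∷ : UniqueLabels L → ¬ Labelled L z → UniqueLabels ((z , l) ∷ L)
uniqueLabels-∷ unique fresh (here refl) (here refl) = refl
uniqueLabels-∷ unique fresh (here refl) (there m)   = ⊥-elim (fresh (_ , m))
uniqueLabels-∷ unique fresh (there m)   (here refl) = ⊥-elim (fresh (_ , m))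
uniqueLabels-∷ unique fresh (there m)   (there m′)  = unique m m′

_≡±_ : ℤ → ℕ → Set
l ≡± v = l ≡ + v ⊎ l ≡ - (+ v)

Oriented : Fin n → Fin n → ℕ → ℤ → Set
Oriented x y v l = (toℕ x < toℕ y × l ≡ + v) ⊎ (toℕ y < toℕ x × l ≡ - (+ v))

oriented⇒≢ : Oriented x y v l → toℕ x ≢ toℕ y
oriented⇒≢ (inj₁ (x<y , _)) = <⇒≢ x<y
oriented⇒≢ (inj₂ (y<x , _)) = λ eq → <⇒≢ y<x (sym eq)

Within : ℕ → ℤ → Set
Within v l = - (+ v) ℤ.< l × l ℤ.< + v

≡±-within : l ≡± suc k → suc k < v → Within v l
≡±-within {v = suc _} (inj₁ refl) (s≤s k<v) = -<+ , +<+ (s≤s k<v)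
≡±-within {v = suc _} (inj₂ refl) (s≤s k<v) = -<- k<v , -<+

oriented-order : Oriented x y v lx → Within v ly → (toℕ x < toℕ y ⇔ ly ℤ.< lx)
oriented-order (inj₁ (x<y , refl)) (_ , ly<v) = mk⇔ (λ _ → ly<v) (λ _ → x<y)
oriented-order (inj₂ (y<x , refl)) (-v<ly , _) =
  mk⇔ (λ x<y → ⊥-elim (<-asym x<y y<x)) (λ ly<-v → ⊥-elim (ℤ.<-asym ly<-v -v<ly))

-- The edge x ≺ y was added when x was labelled by ±v, before stage k and while y was unlabelled.
EdgeLabelled : ℕ → Labels n → Fin n → Fin n → Set
EdgeLabelled k L x y =
  ∃ λ v → k < v × ∃ λ lx → (x , lx) ∈ L × Oriented x y v lx × (∀ {ly} → (y , ly) ∈ L → Within v ly)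

EdgesLabelled : ℕ → Edges n → Labels n → Set
EdgesLabelled k E L = ∀ {x y} → (x , y) ∈ E → EdgeLabelled k L x y

edgesLabelled-relabel : EdgesLabelled (suc k) E L → l ≡± suc k → EdgesLabelled k E ((z , l) ∷ L)
edgesLabelled-relabel edges l≡±k e with edges e
... | v , k<v , lx , x∈L , oriented , within =
  v , <⇒≤ k<v , lx , there x∈L , oriented ,
  λ { (here refl) → ≡±-within l≡±k k<v ; (there m) → within m }

edgesLabelled-∷ : EdgesLabelled k E ((x , l) ∷ L) → Oriented x y (suc k) l → ¬ Labelled L y →
  EdgesLabelled k ((x , y) ∷ E) ((x , l) ∷ L)
edgesLabelled-∷ {x = x} {y = y} edges oriented fresh (here refl) =
  _ , n<1+n _ , _ , here refl , oriented , unlabelled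
  where
  unlabelled : ∀ {ly} → (y , ly) ∈ ((x , _) ∷ _) → Within (suc _) ly
  unlabelled (here refl) = ⊥-elim (oriented⇒≢ oriented refl)
  unlabelled (there m)   = ⊥-elim (fresh (_ , m))
edgesLabelled-∷ edges oriented fresh (there e) = edges e

<P-∷ : ∀ {e} → _<P_ E x y → _<P_ (e ∷ E) x y
<P-∷ [ e ]       = [ there e ]
<P-∷ (e ∷ x<Py) = there e ∷ <P-∷ x<Py

cover⇒added : Cover E x y → Added E x y
cover⇒added ([ e ] , _)        = e
cover⇒added ((e ∷ x<Py) , nc) = ⊥-elim (nc (_ , [ e ] , x<Py))

cover-order : UniqueLabels L → EdgesLabelled k E L → Cover E x y →
  (x , lx) ∈ L → (y , ly) ∈ L → (toℕ x < toℕ y ⇔ ly ℤ.< lx)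
cover-order unique edges x⋖y x∈L y∈L with edges (cover⇒added x⋖y)
... | _ , _ , _ , x∈L′ , oriented , within rewrite unique x∈L x∈L′ =
  oriented-order oriented (within y∈L)

module _ {n : ℕ} (π : Permutation′ (suc n)) where

  private
    variable
      i j p q p′ q′ ℓ r : Fin (suc n)
      k′ : ℕ
      E′ : Edges n
      a b : Fin n

  val-injective : val π i ≡ val π j → i ≡ j
  val-injective eq = Injection.injective (↔⇒↣ π) (toℕ-injective (suc-injective eq))

  _∈[_,_⟩ : Fin n → Fin (suc n) → Fin (suc n) → Set
  z ∈[ p , q ⟩ = toℕ p ≤ toℕ z × toℕ z < toℕ q

  -- p < q are adjacent among the positions with value ≤ k: after the values above k
  -- have been processed, the bars between p and q form one block.
  Consecutive : ℕ → Fin (suc n) → Fin (suc n) → Set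
  Consecutive k p q = toℕ p < toℕ q × val π p ≤ k × val π q ≤ k ×
                      (∀ j → toℕ p < toℕ j → toℕ j < toℕ q → k < val π j)

  consecutive-nested : k ≤ k′ → Consecutive k p q → Consecutive k′ p′ q′ →
    z ∈[ p , q ⟩ → z ∈[ p′ , q′ ⟩ → toℕ p ≤ toℕ p′ × toℕ q′ ≤ toℕ q
  consecutive-nested {p = p} {q = q} k≤k′ (_ , vp , vq , _) (_ , _ , _ , between′)
                     (p≤z , z<q) (p′≤z , z<q′) =
    ≮⇒≥ (λ p′<p → ≤⇒≯ (≤-trans vp k≤k′) (between′ p p′<p (≤-<-trans p≤z z<q′))) ,
    ≮⇒≥ (λ q<q′ → ≤⇒≯ (≤-trans vq k≤k′) (between′ q (≤-<-trans p′≤z z<q) q<q′))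

  isLeft-nearest : IsLeft π i ℓ → toℕ q < toℕ i → val π q < val π i → toℕ q ≤ toℕ ℓ
  isLeft-nearest {q = q} (_ , _ , between) q<i vq<vi = ≮⇒≥ (λ ℓ<q → <-asym vq<vi (between q ℓ<q q<i))

  isRight-nearest : IsRight π i r → toℕ i < toℕ q → val π q < val π i → toℕ r ≤ toℕ q
  isRight-nearest {q = q} (_ , _ , between) i<q vq<vi = ≮⇒≥ (λ q<r → <-asym vq<vi (between q i<q q<r))

  Dominated : Edges n → Fin (suc n) → Fin (suc n) → Fin n → Set
  Dominated E p q z = ∃ λ s → s ∈[ p , q ⟩ × _<P_ E z s

  LabelledNonMaximal : ℕ → Edges n → Labels n → Set
  LabelledNonMaximal k E L =
    ∀ {z p q} → Labelled L z → Consecutive k p q → z ∈[ p , q ⟩ → Dominated E p q z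

  maximal-unlabelled : LabelledNonMaximal k E L → Consecutive k p q → Maximal E (_∈[ p , q ⟩) z →
    ¬ Labelled L z
  maximal-unlabelled nonMaximal cons (z∈pq , maximal) labelled with nonMaximal labelled cons z∈pq
  ... | s , s∈pq , z<s = maximal s s∈pq z<s

  module Processing {k : ℕ} {i : Fin (suc n)} (val-i : val π i ≡ suc k) where

    small<val-i : val π q ≤ k → val π q < val π i
    small<val-i vq = <-≤-trans (s≤s vq) (≤-reflexive (sym val-i))

    small≢i : val π q ≤ k → toℕ q ≢ toℕ i
    small≢i vq q≡i = <-irrefl (cong (val π) (toℕ-injective q≡i)) (small<val-i vq)

    above-suc : k < val π j → toℕ j ≢ toℕ i → suc k < val π j
    above-suc k<vj j≢i with m≤n⇒m<n∨m≡n k<vj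
    ... | inj₁ sk<vj = sk<vj
    ... | inj₂ sk≡vj = ⊥-elim (j≢i (cong toℕ (val-injective (trans (sym sk≡vj) (sym val-i)))))

    left-consecutive : IsLeft π i ℓ → Consecutive (suc k) ℓ i
    left-consecutive (ℓ<i , vℓ<vi , between) =
      ℓ<i , <⇒≤ (<-≤-trans vℓ<vi (≤-reflexive val-i)) , ≤-reflexive val-i ,
      λ j ℓ<j j<i → subst (_< val π j) val-i (between j ℓ<j j<i)

    right-consecutive : IsRight π i r → Consecutive (suc k) i r
    right-consecutive (i<r , vr<vi , between) =
      i<r , ≤-reflexive val-i , <⇒≤ (<-≤-trans vr<vi (≤-reflexive val-i)) ,
      λ j i<j j<r → subst (_< val π j) val-i (between j i<j j<r)

    consecutive-keep : Consecutive k p q → ¬ (toℕ p < toℕ i × toℕ i < toℕ q) → Consecutive (suc k) p q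
    consecutive-keep (p<q , vp , vq , between) i∉pq =
      p<q , m≤n⇒m≤1+n vp , m≤n⇒m≤1+n vq ,
      λ j p<j j<q → above-suc (between j p<j j<q)
                      (λ j≡i → i∉pq (subst (toℕ _ <_) j≡i p<j , subst (_< toℕ _) j≡i j<q))

    consecutive-split : Consecutive k p q → toℕ p < toℕ i → toℕ i < toℕ q →
      Consecutive (suc k) p i × Consecutive (suc k) i q
    consecutive-split (p<q , vp , vq , between) p<i i<q =
      (p<i , m≤n⇒m≤1+n vp , ≤-reflexive val-i ,
        λ j p<j j<i → above-suc (between j p<j (<-trans j<i i<q)) (<⇒≢ j<i)) ,
      (i<q , ≤-reflexive val-i , m≤n⇒m≤1+n vq ,
        λ j i<j j<q → above-suc (between j (<-trans p<i i<j) j<q) (λ j≡i → <⇒≢ i<j (sym j≡i)))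

    consecutive-refine : Consecutive k p q → z ∈[ p , q ⟩ →
      ∃₂ λ p′ q′ → Consecutive (suc k) p′ q′ × z ∈[ p′ , q′ ⟩
    consecutive-refine {p = p} {q = q} {z = z} cons (p≤z , z<q) with toℕ z <? toℕ i
    ... | yes z<i with toℕ i <? toℕ q
    ...   | yes i<q = p , i , proj₁ (consecutive-split cons (≤-<-trans p≤z z<i) i<q) , p≤z , z<i
    ...   | no i≮q  = p , q , consecutive-keep cons (λ (_ , i<q) → i≮q i<q) , p≤z , z<q
    consecutive-refine {p = p} {q = q} {z = z} cons (p≤z , z<q) | no z≮i with toℕ p <? toℕ i
    ...   | yes p<i =
      i , q , proj₂ (consecutive-split cons p<i (≤-<-trans (≮⇒≥ z≮i) z<q)) , ≮⇒≥ z≮i , z<q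
    ...   | no p≮i  = p , q , consecutive-keep cons (λ (p<i , _) → p≮i p<i) , p≤z , z<q

    block-around-left-gap : IsLeft π i ℓ → z ∈[ ℓ , i ⟩ → Consecutive k p q → z ∈[ p , q ⟩ →
      toℕ p ≤ toℕ ℓ × toℕ i < toℕ q
    block-around-left-gap isL z∈ℓi cons@(_ , _ , vq , _) z∈pq
      with consecutive-nested (n≤1+n _) cons (left-consecutive isL) z∈pq z∈ℓi
    ... | p≤ℓ , i≤q = p≤ℓ , ≤∧≢⇒< i≤q (λ i≡q → small≢i vq (sym i≡q))

    block-around-right-gap : IsRight π i r → z ∈[ i , r ⟩ → Consecutive k p q → z ∈[ p , q ⟩ →
      toℕ p < toℕ i × toℕ r ≤ toℕ q
    block-around-right-gap isR z∈ir cons@(_ , vp , _ , _) z∈pq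
      with consecutive-nested (n≤1+n _) cons (right-consecutive isR) z∈pq z∈ir
    ... | p≤i , r≤q = ≤∧≢⇒< p≤i (small≢i vp) , r≤q

    ltr-right-gap-outside : LTRMin π i → IsRight π i r → z ∈[ i , r ⟩ →
      Consecutive k p q → ¬ z ∈[ p , q ⟩
    ltr-right-gap-outside {p = p} ltr isR z∈ir cons@(_ , vp , _ , _) z∈pq =
      <-asym (small<val-i vp) (ltr p (proj₁ (block-around-right-gap isR z∈ir cons z∈pq)))

    rtl-left-gap-outside : RTLMin π i → IsLeft π i ℓ → z ∈[ ℓ , i ⟩ →
      Consecutive k p q → ¬ z ∈[ p , q ⟩
    rtl-left-gap-outside {q = q} rtl isL z∈ℓi cons@(_ , _ , vq , _) z∈pq =
      <-asym (small<val-i vq) (rtl q (proj₂ (block-around-left-gap isL z∈ℓi cons z∈pq)))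

    block-covers-right-gap : IsLeft π i ℓ → IsRight π i r → a ∈[ ℓ , i ⟩ → b ∈[ i , r ⟩ →
      Consecutive k p q → a ∈[ p , q ⟩ → b ∈[ p , q ⟩
    block-covers-right-gap isL isR a∈ℓi@(_ , a<i) (i≤b , b<r) cons@(_ , _ , vq , _) a∈pq@(p≤a , _)
      with block-around-left-gap isL a∈ℓi cons a∈pq
    ... | _ , i<q =
      ≤-trans p≤a (<⇒≤ (<-≤-trans a<i i≤b)) , <-≤-trans b<r (isRight-nearest isR i<q (small<val-i vq))

    block-covers-left-gap : IsLeft π i ℓ → IsRight π i r → a ∈[ ℓ , i ⟩ → b ∈[ i , r ⟩ →
      Consecutive k p q → b ∈[ p , q ⟩ → a ∈[ p , q ⟩
    block-covers-left-gap isL isR (ℓ≤a , a<i) b∈ir@(i≤b , _) cons@(_ , vp , _ , _) b∈pq@(_ , b<q)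
      with block-around-right-gap isR b∈ir cons b∈pq
    ... | p<i , _ =
      ≤-trans (isLeft-nearest isL p<i (small<val-i vp)) ℓ≤a , <-trans a<i (≤-<-trans i≤b b<q)

    nonMaximal-step : LabelledNonMaximal (suc k) E L → (∀ {x y} → _<P_ E x y → _<P_ E′ x y) →
      (∀ {p q} → Consecutive k p q → z ∈[ p , q ⟩ → Dominated E′ p q z) →
      LabelledNonMaximal k E′ ((z , l) ∷ L)
    nonMaximal-step nonMaximal mono new (_ , here refl) cons z∈pq = new cons z∈pq
    nonMaximal-step nonMaximal mono new (_ , there m) cons z∈pq with consecutive-refine cons z∈pq
    ... | p′ , q′ , cons′ , z∈p′q′
      with nonMaximal (_ , m) cons′ z∈p′q′ | consecutive-nested (n≤1+n _) cons cons′ z∈pq z∈p′q′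
    ... | s , (p′≤s , s<q′) , z<s | p≤p′ , q′≤q =
      s , (≤-trans p≤p′ p′≤s , <-≤-trans s<q′ q′≤q) , mono z<s

  record Invariant (k : ℕ) (E : Edges n) (L : Labels n) : Set where
    field
      nonMaximal : LabelledNonMaximal k E L
      unique     : UniqueLabels L
      edges      : EdgesLabelled k E L

  invariant : ∀ {Y} → Built π Y k E L → Invariant k E L
  invariant start = record { nonMaximal = λ { (_ , ()) } ; unique = λ () ; edges = λ () }
  invariant (stepLTR _ _ B i refl ltr r b isR (max@(b∈ir , _) , _)) = record
    { nonMaximal = nonMaximal-step nonMaximal id
        λ cons b∈pq → ⊥-elim (ltr-right-gap-outside ltr isR b∈ir cons b∈pq)
    ; unique     = uniqueLabels-∷ unique (maximal-unlabelled nonMaximal (right-consecutive isR) max)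
    ; edges      = edgesLabelled-relabel edges (inj₂ refl)
    }
    where open Invariant (invariant B)
          open Processing {i = i} refl
  invariant (stepRTL _ _ B i refl rtl ℓ a isL (max@(a∈ℓi , _) , _)) = record
    { nonMaximal = nonMaximal-step nonMaximal id
        λ cons a∈pq → ⊥-elim (rtl-left-gap-outside rtl isL a∈ℓi cons a∈pq)
    ; unique     = uniqueLabels-∷ unique (maximal-unlabelled nonMaximal (left-consecutive isL) max)
    ; edges      = edgesLabelled-relabel edges (inj₁ refl)
    }
    where open Invariant (invariant B)
          open Processing {i = i} refl
  invariant (stepInY _ _ B i refl ℓ r a b isL isR
                     (maxa@(a∈ℓi , _) , _) (maxb@(b∈ir , _) , _) _) = record
    { nonMaximal = nonMaximal-step nonMaximal <P-∷
        λ cons a∈pq → b , block-covers-right-gap isL isR a∈ℓi b∈ir cons a∈pq , [ here refl ]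
    ; unique     = uniqueLabels-∷ unique (maximal-unlabelled nonMaximal (left-consecutive isL) maxa)
    ; edges      = edgesLabelled-∷ (edgesLabelled-relabel edges (inj₁ refl))
                     (inj₁ (<-≤-trans (proj₂ a∈ℓi) (proj₁ b∈ir) , refl))
                     (maximal-unlabelled nonMaximal (right-consecutive isR) maxb)
    }
    where open Invariant (invariant B)
          open Processing {i = i} refl
  invariant (stepNotInY _ _ B i refl ℓ r a b isL isR
                        (maxa@(a∈ℓi , _) , _) (maxb@(b∈ir , _) , _) _) = record
    { nonMaximal = nonMaximal-step nonMaximal <P-∷
        λ cons b∈pq → a , block-covers-left-gap isL isR a∈ℓi b∈ir cons b∈pq , [ here refl ]
    ; unique     = uniqueLabels-∷ unique (maximal-unlabelled nonMaximal (right-consecutive isR) maxb)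
    ; edges      = edgesLabelled-∷ (edgesLabelled-relabel edges (inj₂ refl))
                     (inj₂ (<-≤-trans (proj₂ a∈ℓi) (proj₁ b∈ir) , refl))
                     (maximal-unlabelled nonMaximal (left-consecutive isL) maxa)
    }
    where open Invariant (invariant B)
          open Processing {i = i} refl

lemma2p12 : (n : ℕ) → 1 ≤ n → (π : Permutation′ (suc n)) → (Y : ℕ → Set) →
    (∀ i → LTRMin π i → ¬ Y (val π i)) →
    (∀ i → RTLMin π i → ¬ (val π i ≡ 1) → Y (val π i)) →
    ∀ (E : Edges n) (L : Labels n) → Built π Y 1 E L →
    ∀ (a b : Fin n) → Cover E a b →
    ∀ (la lb : ℤ) → (a , la) ∈ L → (b , lb) ∈ L →
    (toℕ a < toℕ b ⇔ lb ℤ.< la)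
lemma2p12 _ _ π _ _ _ _ _ B _ _ a⋖b _ _ = cover-order unique edges a⋖b
  where open Invariant (invariant π B)
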